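{- Let $n \ge 4$ be an integer, and define the sequence of integers $(k_j)_{j\ge 0}$ by \[ k_0 = \pi(n), \qquad k_{j+1} = \pi(n-k_j) \quad (j \ge 0). \] Then after a finite number of steps exactly one of the following cases occurs: (i) the sequence reaches a fixed point $k^{*}$, i.e., there is $J$ such that $k_j = k^{*}$ for all $j \ge J$ and $\pi(n-k^{*}) = k^{*}$; (ii) the sequence reaches a cycle $\{k',k''\}$ with $k'' = k'+1$ and $n-k'$ a prime number, where $(k_{2j})_{j\ge0}$ is a decreasing sequence which converges to $k''$, and $(k_{2j+1})_{j\ge0}$ is an increasing sequence which converges to $k'$.
   Context: $\pi(x)$ denotes the number of prime numbers less than or equal to $x$ (the prime-counting function). $p_k$ denotes the $k$th prime number, with $p_1 = 2$. Since the $k_j$ are integers, convergence means being eventually constant. -}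

module Defs where

open import Data.Nat using (ℕ; zero; suc; _+_; _*_; _∸_; _≤_)
open import Data.Bool using (if_then_else_)
open import Data.Nat.Primality using (Prime; prime?)
open import Data.Product using (Σ; _×_)
open import Relation.Nullary.Decidable using (does)
open import Relation.Binary.PropositionalEquality using (_≡_)

primeCount : ℕ → ℕ
primeCount zero = zero
primeCount (suc m) = (if does (prime? (suc m)) then 1 else 0) + primeCount m

-- the sequence k_j for a given n:  k_0 = π(n),  k_{j+1} = π(n - k_j)
-- (truncated subtraction is harmless: k_j = π(·) ≤ n always)
kseq : ℕ → ℕ → ℕ
kseq n zero = primeCount n
kseq n (suc j) = primeCount (n ∸ kseq n j)

FixedPointCase : ℕ → Set
FixedPointCase n = Σ ℕ λ kstar → Σ ℕ λ J →
  ((j : ℕ) → J ≤ j → kseq n j ≡ kstar) × (primeCount (n ∸ kstar) ≡ kstar)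

CycleCase : ℕ → Set
CycleCase n = Σ ℕ λ k' → Σ ℕ λ k'' →
  (k'' ≡ k' + 1) × Prime (n ∸ k') ×
  ((j : ℕ) → kseq n (2 * suc j) ≤ kseq n (2 * j)) ×
  (Σ ℕ λ J → (j : ℕ) → J ≤ j → kseq n (2 * j) ≡ k'') ×
  ((j : ℕ) → kseq n (suc (2 * j)) ≤ kseq n (suc (2 * suc j))) ×
  (Σ ℕ λ J → (j : ℕ) → J ≤ j → kseq n (suc (2 * j)) ≡ k')

-- Put f k = π(n − k), so that k_{j+1} = f(k_j) and k_0 = f(0). Since f is antitone,
-- the even terms of the orbit of f decrease, the odd terms increase, and odd ≤ even;
-- so the even terms reach a fixed point a of f ∘ f, and b = f(a) ≤ a with f(b) = a.
-- If b = a this is case (i). Otherwise π(n − b) − π(n − a) = a − b, so all a − b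
-- integers in (n − a, n − b] are prime. A run of primes has length at most 2, and
-- length 2 only for {2, 3}, which would force b = π(1) = 0 and n = 3; hence
-- a = b + 1 and n − b is prime, which is case (ii). The cases exclude each other
-- because in (ii) the even and odd terms eventually differ.
module Submission where

open import Defs
open import Data.Nat using (ℕ; zero; suc; _+_; _*_; _∸_; _≤_; _<_; _≤′_; ≤′-refl; ≤′-step; _≟_; z≤n; s≤s)
open import Data.Nat.Properties
open import Data.Nat.Divisibility using (_∣_; _∣0; ∣-refl; ∣m∣n⇒∣m+n)
open import Data.Nat.Primality
  using (Prime; prime?; prime⇒irreducible; ¬prime[1]; composite[4]; composite⇒¬prime)
open import Data.Sum using (_⊎_; inj₁; inj₂)
open import Data.Product using (∃; _×_; _,_)
open import Relation.Nullary using (¬_; yes; no; contradiction)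
open import Relation.Binary.PropositionalEquality
open import Function using (_∘_)

even∨odd : ∀ m → 2 ∣ m ⊎ 2 ∣ suc m
even∨odd zero = inj₁ (2 ∣0)
even∨odd (suc m) with even∨odd m
... | inj₁ 2∣m = inj₂ (∣m∣n⇒∣m+n ∣-refl 2∣m)
... | inj₂ 2∣1+m = inj₁ 2∣1+m

even-prime : ∀ {p} → Prime p → 2 ∣ p → p ≡ 2
even-prime pp 2∣p with prime⇒irreducible pp 2∣p
... | inj₁ ()
... | inj₂ 2≡p = sym 2≡p

consecutive-primes : ∀ {p} → Prime p → Prime (suc p) → p ≡ 2
consecutive-primes {p} pp pp+1 with even∨odd p
... | inj₁ 2∣p = even-prime pp 2∣p
... | inj₂ 2∣p+1 with even-prime pp+1 2∣p+1
...   | refl = contradiction pp ¬prime[1]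

primeRun-length : ∀ {d x} → (∀ i → i < d → Prime (suc i + x)) →
                  d ≤ 1 ⊎ (x ≡ 1 × d ≡ 2)
primeRun-length {zero} _ = inj₁ z≤n
primeRun-length {suc zero} _ = inj₁ ≤-refl
primeRun-length {suc (suc d)} run
  with consecutive-primes (run 0 (s≤s z≤n)) (run 1 (s≤s (s≤s z≤n)))
primeRun-length {suc (suc zero)} run | refl = inj₂ (refl , refl)
primeRun-length {suc (suc (suc d))} run | refl =
  contradiction (run 2 (s≤s (s≤s (s≤s z≤n)))) (composite⇒¬prime composite[4])

primeCount-mono : ∀ {m m'} → m ≤ m' → primeCount m ≤ primeCount m'
primeCount-mono {m' = zero} z≤n = ≤-refl
primeCount-mono {m' = suc m'} m≤1+m' with m≤n⇒m<n∨m≡n m≤1+m'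
... | inj₂ refl = ≤-refl
... | inj₁ (s≤s m≤m') = ≤-trans (primeCount-mono m≤m') (m≤n+m (primeCount m') _)

primeCount≤ : ∀ m → primeCount m ≤ m
primeCount≤ zero = z≤n
primeCount≤ (suc m) with prime? (suc m)
... | yes _ = s≤s (primeCount≤ m)
... | no _ = m≤n⇒m≤1+n (primeCount≤ m)

primeCount-+-≤ : ∀ d x → primeCount (d + x) ≤ d + primeCount x
primeCount-+-≤ zero x = ≤-refl
primeCount-+-≤ (suc d) x with prime? (suc (d + x))
... | yes _ = s≤s (primeCount-+-≤ d x)
... | no _ = m≤n⇒m≤1+n (primeCount-+-≤ d x)

primeCount-+-≡⇒Prime : ∀ d x → primeCount (d + x) ≡ d + primeCount x →
                       ∀ i → i < d → Prime (suc i + x)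
primeCount-+-≡⇒Prime (suc d) x eq i i<1+d with prime? (suc (d + x))
... | no _ = contradiction (≤-reflexive (sym eq)) (<⇒≱ (s≤s (primeCount-+-≤ d x)))
... | yes p with m≤n⇒m<n∨m≡n (≤-pred i<1+d)
...   | inj₁ i<d = primeCount-+-≡⇒Prime d x (suc-injective eq) i i<d
...   | inj₂ refl = p

primeCount-twoCycle : ∀ {n a b} → 4 ≤ n → b < a →
  primeCount (n ∸ a) ≡ b → primeCount (n ∸ b) ≡ a → a ≡ b + 1 × Prime (n ∸ b)
primeCount-twoCycle {n} {a} {b} 4≤n b<a π[n∸a]≡b π[n∸b]≡a = conclude (primeRun-length run)
  where
  open ≡-Reasoning
  x d : ℕ
  x = n ∸ a
  d = a ∸ b
  a≤n : a ≤ n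
  a≤n = ≤-trans (≤-reflexive (sym π[n∸b]≡a)) (≤-trans (primeCount≤ (n ∸ b)) (m∸n≤m n b))
  n∸b≡d+x : n ∸ b ≡ d + x
  n∸b≡d+x = begin
    n ∸ b          ≡⟨ cong (_∸ b) (sym (m∸n+n≡m a≤n)) ⟩
    x + a ∸ b      ≡⟨ +-∸-assoc x (<⇒≤ b<a) ⟩
    x + d          ≡⟨ +-comm x d ⟩
    d + x          ∎
  run : ∀ i → i < d → Prime (suc i + x)
  run = primeCount-+-≡⇒Prime d x (begin
    primeCount (d + x)  ≡⟨ cong primeCount (sym n∸b≡d+x) ⟩
    primeCount (n ∸ b)  ≡⟨ π[n∸b]≡a ⟩
    a                   ≡⟨ sym (m∸n+n≡m (<⇒≤ b<a)) ⟩
    d + b               ≡⟨ cong (d +_) (sym π[n∸a]≡b) ⟩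
    d + primeCount x    ∎)
  conclude : d ≤ 1 ⊎ (x ≡ 1 × d ≡ 2) → a ≡ b + 1 × Prime (n ∸ b)
  conclude (inj₁ d≤1) = a≡b+1 , subst Prime (sym (trans n∸b≡d+x (cong (_+ x) d≡1))) (run 0 0<d)
    where
    0<d : 0 < d
    0<d = m<n⇒0<n∸m b<a
    d≡1 : d ≡ 1
    d≡1 = ≤-antisym d≤1 0<d
    a≡b+1 : a ≡ b + 1
    a≡b+1 = begin
      a      ≡⟨ sym (m∸n+n≡m (<⇒≤ b<a)) ⟩
      d + b  ≡⟨ cong (_+ b) d≡1 ⟩
      1 + b  ≡⟨ +-comm 1 b ⟩
      b + 1  ∎
  -- The run {2, 3} would give b = π(1) = 0 and n = n − b = 3.
  conclude (inj₂ (x≡1 , d≡2)) = contradiction 4≤n (<⇒≱ (s≤s (≤-reflexive n≡3)))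
    where
    n≡3 : n ≡ 3
    n≡3 = begin
      n      ≡⟨ cong (n ∸_) (trans (cong primeCount (sym x≡1)) π[n∸a]≡b) ⟩
      n ∸ b  ≡⟨ n∸b≡d+x ⟩
      d + x  ≡⟨ cong₂ _+_ d≡2 x≡1 ⟩
      3      ∎

module _ {g : ℕ → ℕ} where

  orbit-constant : ∀ {s : ℕ → ℕ} → (∀ j → s (suc j) ≡ g (s j)) →
                   ∀ {J} → g (s J) ≡ s J → ∀ j → J ≤ j → s j ≡ s J
  orbit-constant {s} step {J} fixed j J≤j = go (≤⇒≤′ J≤j)
    where
    go : ∀ {j} → J ≤′ j → s j ≡ s J
    go ≤′-refl = refl
    go {suc j} (≤′-step J≤′j) = trans (step j) (trans (cong g (go J≤′j)) fixed)

  -- Constructively a decreasing sequence need not visibly stabilise; for an orbit,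
  -- deciding s 1 ≟ s 0 either yields the fixed point or lowers the bound on s 0.
  decreasing-orbit-fixedPoint : ∀ m {s : ℕ → ℕ} → (∀ j → s (suc j) ≡ g (s j)) →
    (∀ j → s (suc j) ≤ s j) → s 0 ≤ m → ∃ λ J → g (s J) ≡ s J
  decreasing-orbit-fixedPoint m {s} step dec s0≤m with s 1 ≟ s 0
  ... | yes s1≡s0 = 0 , trans (sym (step 0)) s1≡s0
  ... | no s1≢s0 with m | ≤-trans (≤∧≢⇒< (dec 0) s1≢s0) s0≤m
  ...   | suc m' | s≤s s1≤m'
    with decreasing-orbit-fixedPoint m' (λ j → step (suc j)) (λ j → dec (suc j)) s1≤m'
  ...     | J , fixed = suc J , fixed

module AntitoneOrbit (f : ℕ → ℕ) (f-anti : ∀ {k k'} → k ≤ k' → f k' ≤ f k)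
  (s : ℕ → ℕ) (start : s 0 ≡ f 0) (step : ∀ j → s (suc j) ≡ f (s j)) where

  odd-step : ∀ j → s (suc (2 * j)) ≡ f (s (2 * j))
  odd-step j = step (2 * j)

  even-step : ∀ j → s (2 * suc j) ≡ f (s (suc (2 * j)))
  even-step j = trans (cong s (*-suc 2 j)) (step (suc (2 * j)))

  even-step² : ∀ j → s (2 * suc j) ≡ f (f (s (2 * j)))
  even-step² j = trans (even-step j) (cong f (odd-step j))

  below-start : ∀ {k} → f k ≤ s 0
  below-start = ≤-trans (f-anti z≤n) (≤-reflexive (sym start))

  even-decreasing : ∀ j → s (2 * suc j) ≤ s (2 * j)
  even-decreasing zero = ≤-trans (≤-reflexive (even-step 0)) below-start
  even-decreasing (suc j) = begin
    s (2 * suc (suc j))      ≡⟨ even-step² (suc j) ⟩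
    f (f (s (2 * suc j)))    ≤⟨ f-anti (f-anti (even-decreasing j)) ⟩
    f (f (s (2 * j)))        ≡⟨ even-step² j ⟨
    s (2 * suc j)            ∎
    where open ≤-Reasoning

  odd-increasing : ∀ j → s (suc (2 * j)) ≤ s (suc (2 * suc j))
  odd-increasing j = begin
    s (suc (2 * j))          ≡⟨ odd-step j ⟩
    f (s (2 * j))            ≤⟨ f-anti (even-decreasing j) ⟩
    f (s (2 * suc j))        ≡⟨ odd-step (suc j) ⟨
    s (suc (2 * suc j))      ∎
    where open ≤-Reasoning

  odd≤even : ∀ j → s (suc (2 * j)) ≤ s (2 * j)
  odd≤even zero = ≤-trans (≤-reflexive (odd-step 0)) below-start
  odd≤even (suc j) = begin
    s (suc (2 * suc j))      ≡⟨ odd-step (suc j) ⟩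
    f (s (2 * suc j))        ≡⟨ cong f (even-step j) ⟩
    f (f (s (suc (2 * j))))  ≤⟨ f-anti (f-anti (odd≤even j)) ⟩
    f (f (s (2 * j)))        ≡⟨ cong f (odd-step j) ⟨
    f (s (suc (2 * j)))      ≡⟨ even-step j ⟨
    s (2 * suc j)            ∎
    where open ≤-Reasoning

module Sequence (n : ℕ) where

  next : ℕ → ℕ
  next k = primeCount (n ∸ k)

  open AntitoneOrbit next (λ k≤k' → primeCount-mono (∸-monoʳ-≤ n k≤k'))
                     (kseq n) refl (λ _ → refl) public

  fixedPoint⇒FixedPointCase : ∀ {J} → next (kseq n J) ≡ kseq n J → FixedPointCase n
  fixedPoint⇒FixedPointCase {J} fixed =
    kseq n J , J , orbit-constant {next} (λ _ → refl) fixed , fixed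

  twoCycle⇒CycleCase : 4 ≤ n → ∀ {J} →
    next (next (kseq n (2 * J))) ≡ kseq n (2 * J) → next (kseq n (2 * J)) < kseq n (2 * J) →
    CycleCase n
  twoCycle⇒CycleCase 4≤n {J} fixed b<a =
    let a≡b+1 , prime[n∸b] = primeCount-twoCycle 4≤n b<a refl fixed
    in b , a , a≡b+1 , prime[n∸b] , even-decreasing , (J , evens) , odd-increasing , (J , odds)
    where
    a b : ℕ
    a = kseq n (2 * J)
    b = next a
    evens : ∀ j → J ≤ j → kseq n (2 * j) ≡ a
    evens = orbit-constant {next ∘ next} {λ j → kseq n (2 * j)} even-step² fixed
    odds : ∀ j → J ≤ j → kseq n (suc (2 * j)) ≡ b
    odds j J≤j = trans (odd-step j) (cong next (evens j J≤j))

  dichotomy : 4 ≤ n → FixedPointCase n ⊎ CycleCase n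
  dichotomy 4≤n
    with decreasing-orbit-fixedPoint {next ∘ next} (kseq n 0) {λ j → kseq n (2 * j)}
           even-step² even-decreasing ≤-refl
  ... | J , fixed with m≤n⇒m<n∨m≡n (odd≤even J)
  ...   | inj₁ b<a = inj₂ (twoCycle⇒CycleCase 4≤n {J} fixed b<a)
  ...   | inj₂ b≡a = inj₁ (fixedPoint⇒FixedPointCase {2 * J} b≡a)

fixedPoint-excludes-cycle : ∀ {n} → FixedPointCase n → ¬ CycleCase n
fixedPoint-excludes-cycle {n} (k* , J₁ , constant , _)
  (k' , k'' , k''≡k'+1 , _ , _ , (J₂ , evens) , _ , (J₃ , odds)) = 1+n≢n (begin
    suc k'                 ≡⟨ +-comm 1 k' ⟩
    k' + 1                 ≡⟨ k''≡k'+1 ⟨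
    k''                    ≡⟨ evens j J₂≤j ⟨
    kseq n (2 * j)         ≡⟨ constant (2 * j) J₁≤2j ⟩
    k*                     ≡⟨ constant (suc (2 * j)) (m≤n⇒m≤1+n J₁≤2j) ⟨
    kseq n (suc (2 * j))   ≡⟨ odds j J₃≤j ⟩
    k'                     ∎)
  where
  open ≡-Reasoning
  j : ℕ
  j = J₁ + J₂ + J₃
  J₁≤2j : J₁ ≤ 2 * j
  J₁≤2j = ≤-trans (≤-trans (m≤m+n J₁ J₂) (m≤m+n _ J₃)) (m≤m+n j _)
  J₂≤j : J₂ ≤ j
  J₂≤j = ≤-trans (m≤n+m J₂ J₁) (m≤m+n _ J₃)
  J₃≤j : J₃ ≤ j
  J₃≤j = m≤n+m J₃ _

theorem1 : (n : ℕ) → 4 ≤ n →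
    (FixedPointCase n ⊎ CycleCase n) × ¬ (FixedPointCase n × CycleCase n)
theorem1 n 4≤n = Sequence.dichotomy n 4≤n , λ (fp , cc) → fixedPoint-excludes-cycle fp cc
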